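{- Let $G=(V_G,E_G)$ be a graph with colouring $f_G:V_G\to[k]$ and $H=(V_H,E_H)$ a graph with $V_H\cap V_G=\emptyset$. If $U\subseteq V_H$ with $|U|=k$ induces a clique in $H$, then, writing $\widetilde{G}=\mathcal{C}(G,f_G,H,U)$, $$\mathrm{ColClique}_k(G,f_G)=\mathrm{ColSubInd}(H,\widetilde{G},f_{\widetilde{G}}).$$ Similarly, if $W\subseteq V_H$ with $|W|=k$ induces an independent set in $H$, then, writing $\widehat{G}=\overline{\mathcal{C}}(G,f_G,H,W)$, $$\mathrm{ColClique}_k(G,f_G)=\mathrm{ColSubInd}(H,\widehat{G},f_{\widehat{G}}).$$
   Context: A vertex subset is colourful with respect to a colouring with colour set $[m]$ if it contains exactly one vertex of each colour in $[m]$. $\mathrm{ColClique}_k(G,f_G)$ is the number of $k$-vertex subsets of $V_G$ that induce a clique and are colourful under $f_G$. For a graph $\Gamma$ with colouring $f$ with colour set $[|V(H)|]$, $\mathrm{ColSubInd}(H,\Gamma,f)$ is the number of colourful subsets $X\subseteq V(\Gamma)$ with $\Gamma[X]\cong H$. Construction $\mathcal{C}(G,f_G,H,U)$ for $U$ a $k$-clique of $H$: choose any bijection $f_H:V_H\to[|V_H|]$ with $f_H(U)\subseteq[k]$; let $V_H'=V_H\setminus U$; vertex set $V_G\cup V_H'$; edge set $E_G\cup\{uv\in E_H:u,v\in V_H'\}\cup\{vw:v\in V_G,w\in V_H',\exists u\in U, uw\in E_H, f_H(u)=f_G(v)\}$; colouring equal to $f_H$ on $V_H'$ and $f_G$ on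 $V_G$. For $W$ a $k$-independent set of $H$ (a clique of the complement $\overline{H}$), $\overline{\mathcal{C}}(G,f_G,H,W)$ is the complement graph of $\mathcal{C}(G,f_G,\overline{H},W)$ with the same colouring as $\mathcal{C}(G,f_G,\overline{H},W)$. -}

module Defs where

open import Data.Bool using (Bool; true; false; not; T; if_then_else_)
open import Data.Nat using (ℕ; zero; suc; _+_; _≤_; _<_)
import Data.Nat.Properties as ℕP
open import Data.Fin using (Fin; toℕ; splitAt; inject≤; _≟_)
open import Data.Fin.Properties using (all?; any?)
open import Data.Fin.Subset using (Subset; _∈_; ∣_∣; ⊤; ∁; inside; outside)
open import Data.Fin.Subset.Properties using (_∈?_; ∣p∣≤n)
open import Data.Fin.Permutation using (Permutation′; _⟨$⟩ʳ_)
open import Data.Vec using (Vec; []; _∷_; lookup; _++_)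
open import Data.List using (List; [_]; map; length; filter) renaming (_++_ to _++ᴸ_)
open import Data.Product using (Σ; ∃; _×_; _,_)
open import Data.Sum using (_⊎_; inj₁; inj₂)
open import Relation.Nullary using (Dec; yes; no; ¬_; does)
open import Relation.Nullary.Decidable using (_×-dec_; _→-dec_; ¬?; T?; map′)
open import Relation.Binary.PropositionalEquality using (_≡_; _≢_; refl; subst) renaming (sym to ≡-sym)

record Graph (n : ℕ) : Set where
  field
    adj    : Fin n → Fin n → Bool
    sym    : ∀ x y → adj x y ≡ adj y x
    irrefl : ∀ x → adj x x ≡ false
open Graph public using (adj; irrefl)

Adj : ∀ {n} → Graph n → Fin n → Fin n → Set
Adj G x y = T (adj G x y)

complAdj : ∀ {n} → Graph n → Fin n → Fin n → Bool
complAdj G x y = if does (x ≟ y) then false else not (adj G x y)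

complement : ∀ {n} → Graph n → Graph n
complement {n} G = record { adj = complAdj G ; sym = s ; irrefl = i }
  where
  s : ∀ x y → complAdj G x y ≡ complAdj G y x
  s x y with x ≟ y | y ≟ x
  ... | yes _ | yes _ = refl
  ... | yes p | no q = Data.Empty.⊥-elim (q (≡-sym p)) where import Data.Empty
  ... | no p | yes q = Data.Empty.⊥-elim (p (≡-sym q)) where import Data.Empty
  ... | no _ | no _ rewrite Graph.sym G x y = refl
  i : ∀ x → complAdj G x x ≡ false
  i x with x ≟ x
  ... | yes _ = refl
  ... | no p = Data.Empty.⊥-elim (p refl) where import Data.Empty

IsClique : ∀ {n} → Graph n → Subset n → Set
IsClique G X = ∀ x y → x ∈ X → y ∈ X → x ≢ y → Adj G x y

IsIndependent : ∀ {n} → Graph n → Subset n → Set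
IsIndependent G X = ∀ x y → x ∈ X → y ∈ X → x ≢ y → ¬ Adj G x y

Colourful : ∀ {n m} → (Fin n → Fin m) → Subset n → Set
Colourful {n} f X =
  ∀ c → (∃ λ x → x ∈ X × f x ≡ c)
      × (∀ x y → x ∈ X → y ∈ X → f x ≡ c → f y ≡ c → x ≡ y)

_⊆ᵛ_ : ∀ {n} → Subset n → Subset n → Set
X ⊆ᵛ V = ∀ x → x ∈ X → x ∈ V

-- Γ[X] ≅ H : there is a map φ : V(H) → V(Γ), injective, with image
-- exactly X, preserving adjacency and non-adjacency.
InducedIso : ∀ {h n} → Graph h → Graph n → Subset n → Set
InducedIso {h} {n} H Γ X =
  ∃ λ (φ : Vec (Fin n) h) →
      (∀ i j → lookup φ i ≡ lookup φ j → i ≡ j)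
    × (∀ i → lookup φ i ∈ X)
    × (∀ x → x ∈ X → ∃ λ i → lookup φ i ≡ x)
    × (∀ i j → adj H i j ≡ adj Γ (lookup φ i) (lookup φ j))

∃Vec? : ∀ {n} h (P : Vec (Fin n) h → Set) → (∀ v → Dec (P v)) → Dec (∃ P)
∃Vec? zero P d with d []
... | yes p = yes ([] , p)
... | no ¬p = no λ { ([] , p) → ¬p p }
∃Vec? (suc h) P d =
  map′ (λ { (x , xs , p) → (x ∷ xs , p) })
       (λ { (x ∷ xs , p) → (x , xs , p) })
       (any? (λ x → ∃Vec? h (λ xs → P (x ∷ xs)) (λ xs → d (x ∷ xs))))

Adj? : ∀ {n} (G : Graph n) x y → Dec (Adj G x y)
Adj? G x y = T? (adj G x y)

IsClique? : ∀ {n} (G : Graph n) X → Dec (IsClique G X)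
IsClique? G X = all? λ x → all? λ y →
  (x ∈? X) →-dec (y ∈? X) →-dec ¬? (x ≟ y) →-dec Adj? G x y

Colourful? : ∀ {n m} (f : Fin n → Fin m) X → Dec (Colourful f X)
Colourful? f X = all? λ c →
  any? (λ x → (x ∈? X) ×-dec (f x ≟ c))
  ×-dec all? (λ x → all? λ y →
     (x ∈? X) →-dec (y ∈? X) →-dec (f x ≟ c) →-dec (f y ≟ c) →-dec (x ≟ y))

⊆ᵛ? : ∀ {n} (X V : Subset n) → Dec (X ⊆ᵛ V)
⊆ᵛ? X V = all? λ x → (x ∈? X) →-dec (x ∈? V)

InducedIso? : ∀ {h n} (H : Graph h) (Γ : Graph n) X → Dec (InducedIso H Γ X)
InducedIso? {h} H Γ X = ∃Vec? h _ λ φ →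
  all? (λ i → all? λ j → (lookup φ i ≟ lookup φ j) →-dec (i ≟ j))
  ×-dec all? (λ i → lookup φ i ∈? X)
  ×-dec all? (λ x → (x ∈? X) →-dec any? (λ i → lookup φ i ≟ x))
  ×-dec all? (λ i → all? λ j → adj H i j Data.Bool.≟ adj Γ (lookup φ i) (lookup φ j))
  where import Data.Bool

allSubsets : ∀ n → List (Subset n)
allSubsets zero    = [ [] ]
allSubsets (suc n) = map (outside ∷_) (allSubsets n) ++ᴸ map (inside ∷_) (allSubsets n)

countSubsets : ∀ {n} {P : Subset n → Set} → (∀ X → Dec (P X)) → ℕ
countSubsets {n} P? = length (filter P? (allSubsets n))

ColClique : ∀ {n} k → Graph n → (Fin n → Fin k) → ℕ
ColClique k G f = countSubsets λ X →
  (∣ X ∣ Data.Nat.≟ k) ×-dec IsClique? G X ×-dec Colourful? f X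
  where import Data.Nat

-- ColSubInd(H, Γ, f) where Γ is the graph with vertex set V ⊆ Fin n
-- and adjacency given by Γg (restricted to V).
ColSubInd : ∀ {h n} → Graph h → Graph n → Subset n → (Fin n → Fin h) → ℕ
ColSubInd H Γg V f = countSubsets λ X →
  ⊆ᵛ? X V ×-dec Colourful? f X ×-dec InducedIso? H Γg X

-- The construction C(G, f_G, H, U).
-- V_G ⊎ V_H is realised as Fin (nG + nH) (V_G on the left, V_H on the
-- right, so they are disjoint); the vertex set of C is V_G ∪ (V_H ∖ U).

module Construction {nG nH k : ℕ} (G : Graph nG) (fG : Fin nG → Fin k)
                    (H : Graph nH) (U : Subset nH) (hU : ∣ U ∣ ≡ k)
                    (fH : Permutation′ nH) where

  k≤nH : k ≤ nH
  k≤nH = subst (_≤ nH) hU (∣p∣≤n U)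

  fG' : Fin nG → Fin nH
  fG' v = inject≤ (fG v) k≤nH

  Cross : Fin nG → Fin nH → Set
  Cross v w = ∃ λ u → u ∈ U × Adj H u w × fH ⟨$⟩ʳ u ≡ fG' v

  cross : Fin nG → Fin nH → Bool
  cross v w = does (any? λ u → (u ∈? U) ×-dec Adj? H u w ×-dec (fH ⟨$⟩ʳ u ≟ fG' v))

  adjS : Fin nG ⊎ Fin nH → Fin nG ⊎ Fin nH → Bool
  adjS (inj₁ a) (inj₁ b) = adj G a b
  adjS (inj₂ a) (inj₂ b) = adj H a b
  adjS (inj₁ v) (inj₂ w) = cross v w
  adjS (inj₂ w) (inj₁ v) = cross v w

  adjS-sym : ∀ x y → adjS x y ≡ adjS y x
  adjS-sym (inj₁ a) (inj₁ b) = Graph.sym G a b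
  adjS-sym (inj₂ a) (inj₂ b) = Graph.sym H a b
  adjS-sym (inj₁ v) (inj₂ w) = refl
  adjS-sym (inj₂ w) (inj₁ v) = refl

  adjS-irr : ∀ x → adjS x x ≡ false
  adjS-irr (inj₁ a) = irrefl G a
  adjS-irr (inj₂ a) = irrefl H a

  -- the graph (adjacency is only meaningful on vertexSet)
  graph : Graph (nG + nH)
  graph = record
    { adj    = λ x y → adjS (splitAt nG x) (splitAt nG y)
    ; sym    = λ x y → adjS-sym (splitAt nG x) (splitAt nG y)
    ; irrefl = λ x → adjS-irr (splitAt nG x)
    }

  vertexSet : Subset (nG + nH)
  vertexSet = ⊤ ++ ∁ U

  colourS : Fin nG ⊎ Fin nH → Fin nH
  colourS (inj₁ v) = fG' v
  colourS (inj₂ w) = fH ⟨$⟩ʳ w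

  colouring : Fin (nG + nH) → Fin nH
  colouring x = colourS (splitAt nG x)

-- Since f_H maps the k vertices of U into [k], U is exactly the set of vertices of H whose colour is
-- below k. Hence a colourful X ⊆ V(C) has the form S ∪ (V_H ∖ U) with S ⊆ V_G colourful for f_G,
-- and S ↦ S ∪ (V_H ∖ U) is the bijection behind the count. If S is a colourful clique, the
-- colour-preserving bijection V_H → X is an isomorphism from H. Conversely, if C[X] ≅ H, the
-- colour-preserving bijection ρ : V_H → X maps non-edges of H to non-edges of C; since C[X] and H
-- have equally many edges, ρ also preserves edges, and the edges of H inside U make S a clique.
-- The independent-set case is the clique case for the complement of H, since complementing both
-- graphs preserves induced copies.

module Submission where

open import Defs
open import Data.Bool using (Bool; true; false; not; T; if_then_else_)
open import Data.Bool.Properties using (not-involutive)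
open import Data.Nat using (ℕ; zero; suc; _+_; _≤_; _<_; z≤n; s≤s)
import Data.Nat.Properties as ℕ
open import Data.Fin using (Fin; zero; suc; toℕ; fromℕ<; inject≤; splitAt; join; _↑ˡ_; _↑ʳ_; _≟_; punchIn)
open import Data.Fin.Properties using (any?; toℕ-injective; toℕ-inject≤; toℕ-fromℕ<; toℕ<n; inject≤-injective; splitAt-join; join-splitAt; ↑ˡ-injective; punchInᵢ≢i)
open import Data.Fin.Subset using (Subset; _∈_; _∉_; _⊆_; ∣_∣; ⊤; ∁; inside; outside)
open import Data.Fin.Subset.Properties using (_∈?_; ∣p∣≤n; ⊆-antisym; p⊂q⇒∣p∣<∣q∣; x∈∁p⇒x∉p; x∉p⇒x∈∁p; ∈⊤)
open import Data.Fin.Permutation using (Permutation′; permutation; _⟨$⟩ʳ_; _⟨$⟩ˡ_; inverseˡ; inverseʳ)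
open import Data.Vec using (Vec; []; _∷_; head; tail; lookup; tabulate; _++_; here; there)
open import Data.Vec.Properties using (lookup∘tabulate; []=⇒lookup; lookup⇒[]=)
open import Data.List as List using (map; length; filter) renaming (_++_ to _++ᴸ_)
open import Data.List.Properties using (length-++; filter-++; filter-≐; filter-none)
import Data.List.Relation.Unary.All as All
open import Data.Product using (∃; _×_; _,_; proj₁; proj₂)
open import Data.Sum using (_⊎_; inj₁; inj₂)
open import Data.Empty using (⊥-elim)
open import Function using (_∘_)
open import Relation.Nullary using (Dec; yes; no; ¬_; does; contradiction)
open import Relation.Nullary.Decidable using (_×-dec_; dec-true; dec-false; T?)
open import Relation.Unary using (Decidable; _≐_)
open import Relation.Binary.PropositionalEquality using (_≡_; _≢_; refl; sym; trans; cong; cong₂; subst; subst₂; _≗_; module ≡-Reasoning)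
open import Algebra.Properties.CommutativeMonoid.Sum ℕ.+-0-commutativeMonoid using (sum; sum-cong-≗; sum-remove; ∑-comm; ∑-permute)

length-filter-map : ∀ {A B : Set} {P : A → Set} (P? : Decidable P) (f : B → A) xs →
  length (filter P? (map f xs)) ≡ length (filter (P? ∘ f) xs)
length-filter-map P? f List.[] = refl
length-filter-map P? f (x List.∷ xs) with does (P? (f x))
... | true  = cong suc (length-filter-map P? f xs)
... | false = length-filter-map P? f xs

countSubsets-cong : ∀ {n} {P Q : Subset n → Set} (P? : Decidable P) (Q? : Decidable Q) →
  P ≐ Q → countSubsets P? ≡ countSubsets Q?
countSubsets-cong {n} P? Q? P≐Q = cong length (filter-≐ P? Q? P≐Q (allSubsets n))

countSubsets-∷ : ∀ {n} {P : Subset (suc n) → Set} (P? : Decidable P) →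
  countSubsets P? ≡ countSubsets (P? ∘ (outside ∷_)) + countSubsets (P? ∘ (inside ∷_))
countSubsets-∷ {n} P? = begin
  length (filter P? (outsides ++ᴸ insides))
    ≡⟨ cong length (filter-++ P? outsides insides) ⟩
  length (filter P? outsides ++ᴸ filter P? insides)
    ≡⟨ length-++ (filter P? outsides) ⟩
  length (filter P? outsides) + length (filter P? insides)
    ≡⟨ cong₂ _+_ (length-filter-map P? _ (allSubsets n)) (length-filter-map P? _ (allSubsets n)) ⟩
  countSubsets (P? ∘ (outside ∷_)) + countSubsets (P? ∘ (inside ∷_)) ∎
  where
  open ≡-Reasoning
  outsides = map (outside ∷_) (allSubsets n)
  insides  = map (inside ∷_) (allSubsets n)

countSubsets-none : ∀ {n} {P : Subset n → Set} (P? : Decidable P) → (∀ X → ¬ P X) →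
  countSubsets P? ≡ 0
countSubsets-none {n} P? ¬P = cong length (filter-none P? (All.universal ¬P (allSubsets n)))

countSubsets-unique : ∀ {n} {P : Subset n → Set} (P? : Decidable P) (X₀ : Subset n) →
  (∀ X → P X → X ≡ X₀) → P X₀ → countSubsets P? ≡ 1
countSubsets-unique P? [] _ P[] with P? []
... | yes _ = refl
... | no ¬P[] = contradiction P[] ¬P[]
countSubsets-unique P? (outside ∷ X₀) unique PX₀ = trans (countSubsets-∷ P?) (cong₂ _+_
  (countSubsets-unique (P? ∘ (outside ∷_)) X₀ (λ X → cong tail ∘ unique _) PX₀)
  (countSubsets-none (P? ∘ (inside ∷_)) (λ X → (λ ()) ∘ cong head ∘ unique _)))
countSubsets-unique P? (inside ∷ X₀) unique PX₀ = trans (countSubsets-∷ P?) (cong₂ _+_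
  (countSubsets-none (P? ∘ (outside ∷_)) (λ X → (λ ()) ∘ cong head ∘ unique _))
  (countSubsets-unique (P? ∘ (inside ∷_)) X₀ (λ X → cong tail ∘ unique _) PX₀))

countSubsets-++ : ∀ n {m} (R₀ : Subset m) {P : Subset (n + m) → Set} (P? : Decidable P)
  {Q : Subset n → Set} (Q? : Decidable Q) →
  (∀ S R → P (S ++ R) → Q S × R ≡ R₀) → (∀ S → Q S → P (S ++ R₀)) →
  countSubsets P? ≡ countSubsets Q?
countSubsets-++ zero R₀ P? Q? P⇒Q Q⇒P with Q? []
... | yes Q[] = countSubsets-unique P? R₀ (λ R → proj₂ ∘ P⇒Q [] R) (Q⇒P [] Q[])
... | no ¬Q[] = countSubsets-none P? (λ R → ¬Q[] ∘ proj₁ ∘ P⇒Q [] R)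
countSubsets-++ (suc n) R₀ P? Q? P⇒Q Q⇒P = begin
  countSubsets P?                                                   ≡⟨ countSubsets-∷ P? ⟩
  countSubsets (P? ∘ (outside ∷_)) + countSubsets (P? ∘ (inside ∷_)) ≡⟨ cong₂ _+_ (split outside) (split inside) ⟩
  countSubsets (Q? ∘ (outside ∷_)) + countSubsets (Q? ∘ (inside ∷_)) ≡⟨ countSubsets-∷ Q? ⟨
  countSubsets Q? ∎
  where
  open ≡-Reasoning
  split : ∀ x → countSubsets (P? ∘ (x ∷_)) ≡ countSubsets (Q? ∘ (x ∷_))
  split x = countSubsets-++ n R₀ (P? ∘ (x ∷_)) (Q? ∘ (x ∷_)) (λ S → P⇒Q (x ∷ S)) (Q⇒P ∘ (x ∷_))

𝟙 : ∀ {a} {A : Set a} → Dec A → ℕ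
𝟙 A? = if does A? then 1 else 0

𝟙-yes : ∀ {a} {A : Set a} (A? : Dec A) → A → 𝟙 A? ≡ 1
𝟙-yes (yes _) _ = refl
𝟙-yes (no ¬a) a = contradiction a ¬a

𝟙-no : ∀ {a} {A : Set a} (A? : Dec A) → ¬ A → 𝟙 A? ≡ 0
𝟙-no (yes a) ¬a = contradiction a ¬a
𝟙-no (no _)  _  = refl

𝟙-mono : ∀ {a b} {A : Set a} {B : Set b} (A? : Dec A) (B? : Dec B) → (A → B) → 𝟙 A? ≤ 𝟙 B?
𝟙-mono (yes a) (no ¬b) A⇒B = contradiction (A⇒B a) ¬b
𝟙-mono (yes _) (yes _) _   = s≤s z≤n
𝟙-mono (no _)  _       _   = z≤n

𝟙-cong : ∀ {a b} {A : Set a} {B : Set b} (A? : Dec A) (B? : Dec B) → (A → B) → (B → A) → 𝟙 A? ≡ 𝟙 B?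
𝟙-cong A? B? A⇒B B⇒A = ℕ.≤-antisym (𝟙-mono A? B? A⇒B) (𝟙-mono B? A? B⇒A)

𝟙-reflects : ∀ {a b} {A : Set a} {B : Set b} (A? : Dec A) (B? : Dec B) → 𝟙 A? ≡ 𝟙 B? → B → A
𝟙-reflects (yes a) _       _  _ = a
𝟙-reflects (no _)  (yes _) () _
𝟙-reflects (no _)  (no ¬b) _  b = contradiction b ¬b

sum-mono-≤ : ∀ {n} {f g : Fin n → ℕ} → (∀ i → f i ≤ g i) → sum f ≤ sum g
sum-mono-≤ {zero}  f≤g = z≤n
sum-mono-≤ {suc n} f≤g = ℕ.+-mono-≤ (f≤g zero) (sum-mono-≤ (f≤g ∘ suc))

sum-≤-reflects-≡ : ∀ {n} {f g : Fin n → ℕ} → (∀ i → f i ≤ g i) → sum g ≤ sum f → f ≗ g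
sum-≤-reflects-≡ {suc n} {f} {g} f≤g g≤f zero = ℕ.≤-antisym (f≤g zero)
  (ℕ.≮⇒≥ λ f₀<g₀ → ℕ.<⇒≱ (ℕ.+-mono-<-≤ f₀<g₀ (sum-mono-≤ (f≤g ∘ suc))) g≤f)
sum-≤-reflects-≡ {suc n} {f} {g} f≤g g≤f (suc i) = sum-≤-reflects-≡ (f≤g ∘ suc)
  (ℕ.≮⇒≥ (λ Σf<Σg → ℕ.<⇒≱ (ℕ.+-mono-≤-< (f≤g zero) Σf<Σg) g≤f)) i

sum-zero : ∀ {n} {f : Fin n → ℕ} → (∀ i → f i ≡ 0) → sum f ≡ 0
sum-zero {zero}  f≡0 = refl
sum-zero {suc n} f≡0 = cong₂ _+_ (f≡0 zero) (sum-zero (f≡0 ∘ suc))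

sum-one : ∀ n → sum {n} (λ _ → 1) ≡ n
sum-one zero    = refl
sum-one (suc n) = cong suc (sum-one n)

sum-δ : ∀ {n} (d : Fin n) → sum (λ c → 𝟙 (c ≟ d)) ≡ 1
sum-δ {suc n} d = trans (sum-remove {i = d} (λ c → 𝟙 (c ≟ d)))
  (cong₂ _+_ (𝟙-yes (d ≟ d) refl) (sum-zero λ c → 𝟙-no (punchIn d c ≟ d) (punchInᵢ≢i d c)))

∣p∣≡∑𝟙 : ∀ {n} (p : Subset n) → ∣ p ∣ ≡ sum (λ x → 𝟙 (x ∈? p))
∣p∣≡∑𝟙 []            = refl
∣p∣≡∑𝟙 (inside ∷ p)  = cong suc (∣p∣≡∑𝟙 p)
∣p∣≡∑𝟙 (outside ∷ p) = ∣p∣≡∑𝟙 p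

∣p∣≡-enumeration : ∀ {n k} (p : Subset n) (e : Fin k → Fin n) → (∀ {c d} → e c ≡ e d → c ≡ d) →
  (∀ c → e c ∈ p) → (∀ x → x ∈ p → ∃ λ c → e c ≡ x) → ∣ p ∣ ≡ k
∣p∣≡-enumeration {n} {k} p e e-injective e∈p onto = begin
  ∣ p ∣                               ≡⟨ ∣p∣≡∑𝟙 p ⟩
  sum (λ x → 𝟙 (x ∈? p))              ≡⟨ sum-cong-≗ 𝟙∈≡∑preimages ⟩
  sum (λ x → sum (λ c → 𝟙 (x ≟ e c))) ≡⟨ ∑-comm (λ x c → 𝟙 (x ≟ e c)) ⟩
  sum (λ c → sum (λ x → 𝟙 (x ≟ e c))) ≡⟨ sum-cong-≗ (sum-δ ∘ e) ⟩
  sum {k} (λ _ → 1)                   ≡⟨ sum-one k ⟩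
  k ∎
  where
  open ≡-Reasoning
  𝟙∈≡∑preimages : ∀ x → 𝟙 (x ∈? p) ≡ sum (λ c → 𝟙 (x ≟ e c))
  𝟙∈≡∑preimages x with x ∈? p
  ... | no x∉p = sym (sum-zero λ c → 𝟙-no (x ≟ e c) λ { refl → x∉p (e∈p c) })
  ... | yes x∈p with onto x x∈p
  ... | c₀ , refl = sym (trans
    (sum-cong-≗ λ c → 𝟙-cong (e c₀ ≟ e c) (c ≟ c₀) (sym ∘ e-injective) (cong e ∘ sym))
    (sum-δ c₀))

p⊆q∧∣q∣≤∣p∣⇒q⊆p : ∀ {n} {p q : Subset n} → p ⊆ q → ∣ q ∣ ≤ ∣ p ∣ → q ⊆ p
p⊆q∧∣q∣≤∣p∣⇒q⊆p {p = p} p⊆q ∣q∣≤∣p∣ {x} x∈q with x ∈? p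
... | yes x∈p = x∈p
... | no x∉p  = contradiction ∣q∣≤∣p∣ (ℕ.<⇒≱ (p⊂q⇒∣p∣<∣q∣ (p⊆q , x , x∈q , x∉p)))

subsetOf : ∀ {n} {P : Fin n → Set} → Decidable P → Subset n
subsetOf P? = tabulate (λ x → does (P? x))

∈-subsetOf⁺ : ∀ {n} {P : Fin n → Set} (P? : Decidable P) {x} → P x → x ∈ subsetOf P?
∈-subsetOf⁺ P? {x} Px = lookup⇒[]= x _ (trans (lookup∘tabulate _ x) (dec-true (P? x) Px))

∈-subsetOf⁻ : ∀ {n} {P : Fin n → Set} (P? : Decidable P) {x} → x ∈ subsetOf P? → P x
∈-subsetOf⁻ P? {x} x∈P with P? x | trans (sym (lookup∘tabulate (λ x → does (P? x)) x)) ([]=⇒lookup x∈P)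
... | yes Px | _ = Px

π⁻¹[<k]⊆U : ∀ {m k} (π : Permutation′ m) (U : Subset m) → ∣ U ∣ ≡ k →
  (∀ {u} → u ∈ U → toℕ (π ⟨$⟩ʳ u) < k) → ∀ {u} → toℕ (π ⟨$⟩ʳ u) < k → u ∈ U
π⁻¹[<k]⊆U {m} {k} π U ∣U∣≡k π[U]<k = p⊆q∧∣q∣≤∣p∣⇒q⊆p U⊆V (ℕ.≤-reflexive (trans ∣V∣≡k (sym ∣U∣≡k))) ∘ ∈-subsetOf⁺ V?
  where
  V? : Decidable λ u → toℕ (π ⟨$⟩ʳ u) < k
  V? u = toℕ (π ⟨$⟩ʳ u) ℕ.<? k
  k≤m : k ≤ m
  k≤m = subst (_≤ m) ∣U∣≡k (∣p∣≤n U)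
  U⊆V : U ⊆ subsetOf V?
  U⊆V = ∈-subsetOf⁺ V? ∘ π[U]<k
  e : Fin k → Fin m
  e c = π ⟨$⟩ˡ inject≤ c k≤m
  πe≡c : ∀ c → π ⟨$⟩ʳ e c ≡ inject≤ c k≤m
  πe≡c c = inverseʳ π
  ∣V∣≡k : ∣ subsetOf V? ∣ ≡ k
  ∣V∣≡k = ∣p∣≡-enumeration (subsetOf V?) e
    (λ {c} {d} ec≡ed → inject≤-injective k≤m k≤m c d (trans (sym (πe≡c c)) (trans (cong (π ⟨$⟩ʳ_) ec≡ed) (πe≡c d))))
    (λ c → ∈-subsetOf⁺ V? (subst (_< k) (sym (trans (cong toℕ (πe≡c c)) (toℕ-inject≤ c k≤m))) (toℕ<n c)))
    (λ u u∈V → let πu<k = ∈-subsetOf⁻ V? u∈V in fromℕ< πu<k ,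
      trans (cong (π ⟨$⟩ˡ_) (toℕ-injective (trans (toℕ-inject≤ _ k≤m) (toℕ-fromℕ< πu<k)))) (inverseˡ π))

edgeCount : ∀ {m} → (Fin m → Fin m → Bool) → ℕ
edgeCount A = sum λ u → sum λ v → 𝟙 (T? (A u v))

edgeCount-permute : ∀ {m} (π : Permutation′ m) (A : Fin m → Fin m → Bool) →
  edgeCount (λ u v → A (π ⟨$⟩ʳ u) (π ⟨$⟩ʳ v)) ≡ edgeCount A
edgeCount-permute π A = trans
  (sum-cong-≗ λ u → sym (∑-permute (λ v → 𝟙 (T? (A (π ⟨$⟩ʳ u) v))) π))
  (sym (∑-permute (λ u → sum λ v → 𝟙 (T? (A u v))) π))

edgeCount-reflects : ∀ {m} (A B : Fin m → Fin m → Bool) → (∀ u v → T (B u v) → T (A u v)) →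
  edgeCount A ≤ edgeCount B → ∀ u v → T (A u v) → T (B u v)
edgeCount-reflects A B B⇒A A≤B u v = 𝟙-reflects (T? (B u v)) (T? (A u v))
  (sum-≤-reflects-≡ (λ v → 𝟙-mono (T? (B u v)) (T? (A u v)) (B⇒A u v)) (ℕ.≤-reflexive (sym (rows-equal u))) v)
  where
  rows-equal : ∀ u → sum (λ v → 𝟙 (T? (B u v))) ≡ sum (λ v → 𝟙 (T? (A u v)))
  rows-equal = sum-≤-reflects-≡ (λ u → sum-mono-≤ λ v → 𝟙-mono (T? (B u v)) (T? (A u v)) (B⇒A u v)) A≤B

edgeCount-cong : ∀ {m} {A B : Fin m → Fin m → Bool} → (∀ u v → A u v ≡ B u v) → edgeCount A ≡ edgeCount B
edgeCount-cong A≡B = sum-cong-≗ λ u → sum-cong-≗ λ v → cong (λ b → 𝟙 (T? b)) (A≡B u v)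

module _ {n m} {f : Fin n → Fin m} {X : Subset n} where

  colourful-injective : Colourful f X → ∀ {x y} → x ∈ X → y ∈ X → f x ≡ f y → x ≡ y
  colourful-injective col {x} {y} x∈X y∈X fx≡fy = proj₂ (col (f x)) x y x∈X y∈X refl (sym fx≡fy)

  representative : Colourful f X → Fin m → Fin n
  representative col c = proj₁ (proj₁ (col c))

  representative-∈ : (col : Colourful f X) → ∀ c → representative col c ∈ X
  representative-∈ col c = proj₁ (proj₂ (proj₁ (col c)))

  representative-colour : (col : Colourful f X) → ∀ c → f (representative col c) ≡ c
  representative-colour col c = proj₂ (proj₂ (proj₁ (col c)))

  representative-unique : (col : Colourful f X) → ∀ {x} → x ∈ X → representative col (f x) ≡ x
  representative-unique col x∈X =
    colourful-injective col (representative-∈ col _) x∈X (representative-colour col _)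

  colourful-card : Colourful f X → ∣ X ∣ ≡ m
  colourful-card col = ∣p∣≡-enumeration X (representative col)
    (λ {c} {d} r[c]≡r[d] → trans (sym (representative-colour col c))
      (trans (cong f r[c]≡r[d]) (representative-colour col d)))
    (representative-∈ col)
    (λ x x∈X → f x , representative-unique col x∈X)

  -- An isomorphism onto a colourful set, composed with the colouring, is a
  -- permutation of the colours.
  edgeCount-inducedIso : ∀ {H : Graph m} {Γ : Graph n} (col : Colourful f X) → InducedIso H Γ X →
    edgeCount (adj H) ≡ edgeCount (λ c d → adj Γ (representative col c) (representative col d))
  edgeCount-inducedIso {H} {Γ} col (φ , φ-injective , φ∈X , φ-onto , φ-adj) = begin
    edgeCount (adj H)                             ≡⟨ edgeCount-cong (λ i j → trans (φ-adj i j)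
                                                       (cong₂ (adj Γ) (r∘τ i) (r∘τ j))) ⟩
    edgeCount (λ i j → A (τ ⟨$⟩ʳ i) (τ ⟨$⟩ʳ j))   ≡⟨ edgeCount-permute τ A ⟩
    edgeCount A ∎
    where
    open ≡-Reasoning
    r = representative col
    A : Fin m → Fin m → Bool
    A c d = adj Γ (r c) (r d)
    τ⁻¹ : Fin m → Fin m
    τ⁻¹ c = proj₁ (φ-onto (r c) (representative-∈ col c))
    φ∘τ⁻¹ : ∀ c → lookup φ (τ⁻¹ c) ≡ r c
    φ∘τ⁻¹ c = proj₂ (φ-onto (r c) (representative-∈ col c))
    τ : Permutation′ m
    τ = permutation (f ∘ lookup φ) τ⁻¹
      (λ c → trans (cong f (φ∘τ⁻¹ c)) (representative-colour col c))
      (λ i → φ-injective _ i (trans (φ∘τ⁻¹ _) (representative-unique col (φ∈X i))))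
    r∘τ : ∀ i → lookup φ i ≡ r (τ ⟨$⟩ʳ i)
    r∘τ i = sym (representative-unique col (φ∈X i))

T-injective : ∀ {x y} → (T x → T y) → (T y → T x) → x ≡ y
T-injective {false} {false} _   _   = refl
T-injective {false} {true}  _   y⇒x = ⊥-elim (y⇒x _)
T-injective {true}  {false} x⇒y _   = ⊥-elim (x⇒y _)
T-injective {true}  {true}  _   _   = refl

T-does⁻ : ∀ {a} {A : Set a} (A? : Dec A) → T (does A?) → A
T-does⁻ (yes a) _ = a

T-does⁺ : ∀ {a} {A : Set a} (A? : Dec A) → A → T (does A?)
T-does⁺ (yes _) _ = _
T-does⁺ (no ¬a) a = ¬a a

¬T⇒T-not : ∀ {b} → ¬ T b → T (not b)
¬T⇒T-not {false} _  = _
¬T⇒T-not {true}  ¬T = ¬T _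

complAdj-≢ : ∀ {n} (G : Graph n) {x y} → x ≢ y → complAdj G x y ≡ not (adj G x y)
complAdj-≢ G {x} {y} x≢y rewrite dec-false (x ≟ y) x≢y = refl

complAdj-involutive : ∀ {n} (G : Graph n) x y → complAdj (complement G) x y ≡ adj G x y
complAdj-involutive G x y with x ≟ y
... | yes refl = sym (irrefl G x)
... | no _     = not-involutive (adj G x y)

InducedIso-cong : ∀ {h n} {H H′ : Graph h} {Γ Γ′ : Graph n} {X} →
  (∀ i j → adj H i j ≡ adj H′ i j) → (∀ x y → adj Γ x y ≡ adj Γ′ x y) →
  InducedIso H Γ X → InducedIso H′ Γ′ X
InducedIso-cong H≡H′ Γ≡Γ′ (φ , φ-injective , φ∈X , φ-onto , φ-adj) =
  φ , φ-injective , φ∈X , φ-onto , λ i j → trans (sym (H≡H′ i j)) (trans (φ-adj i j) (Γ≡Γ′ _ _))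

InducedIso-complement : ∀ {h n} {H : Graph h} {Γ : Graph n} {X} →
  InducedIso H Γ X → InducedIso (complement H) (complement Γ) X
InducedIso-complement {H = H} {Γ} (φ , φ-injective , φ∈X , φ-onto , φ-adj) =
  φ , φ-injective , φ∈X , φ-onto , complAdj-preserved
  where
  complAdj-preserved : ∀ i j → complAdj H i j ≡ complAdj Γ (lookup φ i) (lookup φ j)
  complAdj-preserved i j with i ≟ j
  ... | yes refl = sym (irrefl (complement Γ) (lookup φ i))
  ... | no i≢j   = trans (cong not (φ-adj i j)) (sym (complAdj-≢ Γ (i≢j ∘ φ-injective i j)))

module _ {h n} {H : Graph h} {Γ : Graph n} {X : Subset n} where

  InducedIso-complementʳ : InducedIso H (complement Γ) X → InducedIso (complement H) Γ X
  InducedIso-complementʳ iso = InducedIso-cong {H = complement H} {complement H} {complement (complement Γ)} {Γ}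
    (λ _ _ → refl) (complAdj-involutive Γ) (InducedIso-complement {H = H} {Γ = complement Γ} iso)

  InducedIso-complementˡ : InducedIso (complement H) Γ X → InducedIso H (complement Γ) X
  InducedIso-complementˡ iso = InducedIso-cong {H = complement (complement H)} {H} {complement Γ} {complement Γ}
    (complAdj-involutive H) (λ _ _ → refl) (InducedIso-complement {H = complement H} {Γ = Γ} iso)

ColSubInd-complement : ∀ {h n} (H : Graph h) (Γ : Graph n) V f →
  ColSubInd H (complement Γ) V f ≡ ColSubInd (complement H) Γ V f
ColSubInd-complement H Γ V f = countSubsets-cong
  (λ X → ⊆ᵛ? X V ×-dec Colourful? f X ×-dec InducedIso? H (complement Γ) X)
  (λ X → ⊆ᵛ? X V ×-dec Colourful? f X ×-dec InducedIso? (complement H) Γ X)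
  ( (λ (X⊆V , col , iso) → X⊆V , col , InducedIso-complementʳ {H = H} {Γ} iso)
  , (λ (X⊆V , col , iso) → X⊆V , col , InducedIso-complementˡ {H = H} {Γ} iso))

independent⇒clique-complement : ∀ {n} (G : Graph n) {X} → IsIndependent G X → IsClique (complement G) X
independent⇒clique-complement G indep x y x∈X y∈X x≢y =
  subst T (sym (complAdj-≢ G x≢y)) (¬T⇒T-not (indep x y x∈X y∈X x≢y))

_∈⊎_ : ∀ {n m} → Fin n ⊎ Fin m → Subset n × Subset m → Set
inj₁ i ∈⊎ (S , R) = i ∈ S
inj₂ j ∈⊎ (S , R) = j ∈ R

∈-++⁺ˡ : ∀ {n m} {S : Subset n} {R : Subset m} {i} → i ∈ S → i ↑ˡ m ∈ S ++ R
∈-++⁺ˡ here      = here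
∈-++⁺ˡ (there p) = there (∈-++⁺ˡ p)

∈-++⁻ˡ : ∀ {n m} (S : Subset n) {R : Subset m} {i} → i ↑ˡ m ∈ S ++ R → i ∈ S
∈-++⁻ˡ (inside ∷ S) {i = zero}  here      = here
∈-++⁻ˡ (_ ∷ S)      {i = suc i} (there p) = there (∈-++⁻ˡ S p)

∈-++⁺ʳ : ∀ {n m} (S : Subset n) {R : Subset m} {j} → j ∈ R → n ↑ʳ j ∈ S ++ R
∈-++⁺ʳ []      p = p
∈-++⁺ʳ (_ ∷ S) p = there (∈-++⁺ʳ S p)

∈-++⁻ʳ : ∀ {n m} (S : Subset n) {R : Subset m} {j} → n ↑ʳ j ∈ S ++ R → j ∈ R
∈-++⁻ʳ []      p         = p
∈-++⁻ʳ (_ ∷ S) (there p) = ∈-++⁻ʳ S p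

∈-join⁺ : ∀ {n m} (S : Subset n) {R : Subset m} {y} → y ∈⊎ (S , R) → join n m y ∈ S ++ R
∈-join⁺ S {y = inj₁ i} = ∈-++⁺ˡ
∈-join⁺ S {y = inj₂ j} = ∈-++⁺ʳ S

∈-join⁻ : ∀ {n m} (S : Subset n) {R : Subset m} {y} → join n m y ∈ S ++ R → y ∈⊎ (S , R)
∈-join⁻ S {y = inj₁ i} = ∈-++⁻ˡ S
∈-join⁻ S {y = inj₂ j} = ∈-++⁻ʳ S

∈-splitAt : ∀ {n m} (S : Subset n) {R : Subset m} {x} → x ∈ S ++ R → splitAt n x ∈⊎ (S , R)
∈-splitAt {n} {m} S {x = x} x∈S++R = ∈-join⁻ S (subst (_∈ S ++ _) (sym (join-splitAt n m x)) x∈S++R)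

++-⊆ : ∀ {n m} {S S′ : Subset n} {R R′ : Subset m} → S ⊆ S′ → R ⊆ R′ → S ++ R ⊆ S′ ++ R′
++-⊆ {n} {m} {S} {S′} S⊆S′ R⊆R′ {x} x∈S++R =
  subst (_∈ S′ ++ _) (join-splitAt n m x) (∈-join⁺ S′ (widen (splitAt n x) (∈-splitAt S x∈S++R)))
  where
  widen : ∀ y → y ∈⊎ (S , _) → y ∈⊎ (S′ , _)
  widen (inj₁ i) = S⊆S′
  widen (inj₂ j) = R⊆R′

module CliqueCase {nG nH k} (G : Graph nG) (fG : Fin nG → Fin k) (H : Graph nH)
  (U : Subset nH) (∣U∣≡k : ∣ U ∣ ≡ k) (U-clique : IsClique H U)
  (fH : Permutation′ nH) (fH[U]<k : ∀ u → u ∈ U → toℕ (fH ⟨$⟩ʳ u) < k) where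

  open Construction G fG H U ∣U∣≡k fH

  fH-injective : ∀ {u v} → fH ⟨$⟩ʳ u ≡ fH ⟨$⟩ʳ v → u ≡ v
  fH-injective eq = trans (sym (inverseˡ fH)) (trans (cong (fH ⟨$⟩ˡ_) eq) (inverseˡ fH))

  fG′-injective : ∀ {a b} → fG' a ≡ fG' b → fG a ≡ fG b
  fG′-injective = inject≤-injective k≤nH k≤nH _ _

  fH<k⇒∈U : ∀ {u} → toℕ (fH ⟨$⟩ʳ u) < k → u ∈ U
  fH<k⇒∈U = π⁻¹[<k]⊆U fH U ∣U∣≡k (fH[U]<k _)

  fG′≡fH⇒∈U : ∀ {a u} → fG' a ≡ fH ⟨$⟩ʳ u → u ∈ U
  fG′≡fH⇒∈U {a} eq = fH<k⇒∈U (subst (λ c → toℕ c < k) eq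
    (subst (_< k) (sym (toℕ-inject≤ (fG a) k≤nH)) (toℕ<n (fG a))))

  adj-join : ∀ y y′ → adj graph (join nG nH y) (join nG nH y′) ≡ adjS y y′
  adj-join y y′ = cong₂ adjS (splitAt-join nG nH y) (splitAt-join nG nH y′)

  colouring-join : ∀ y → colouring (join nG nH y) ≡ colourS y
  colouring-join y = cong colourS (splitAt-join nG nH y)

  -- In S ++ (V_H ∖ U) the colour fH u is carried either by some a ∈ S or by u itself.
  data Placement (S : Subset nG) (u : Fin nH) : Fin nG ⊎ Fin nH → Set where
    inG : ∀ {a} → a ∈ S → fG' a ≡ fH ⟨$⟩ʳ u → Placement S u (inj₁ a)
    inH : u ∉ U → Placement S u (inj₂ u)

  placement : ∀ {S R u y} → R ⊆ ∁ U → y ∈⊎ (S , R) → colourS y ≡ fH ⟨$⟩ʳ u → Placement S u y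
  placement {y = inj₁ a} _     a∈S colour = inG a∈S colour
  placement {y = inj₂ j} R⊆∁U j∈R colour with fH-injective colour
  ... | refl = inH (x∈∁p⇒x∉p (R⊆∁U j∈R))

  placement-∈ : ∀ {S u y} → Placement S u y → y ∈⊎ (S , ∁ U)
  placement-∈ (inG a∈S _) = a∈S
  placement-∈ (inH u∉U)   = x∉p⇒x∈∁p u∉U

  placement-colour : ∀ {S u y} → Placement S u y → colourS y ≡ fH ⟨$⟩ʳ u
  placement-colour (inG _ colour) = colour
  placement-colour (inH _)        = refl

  placement-unique : ∀ {S u y y′} → Colourful fG S → Placement S u y → Placement S u y′ → y ≡ y′
  placement-unique S-col (inG a∈S fa) (inG b∈S fb) =
    cong inj₁ (colourful-injective S-col a∈S b∈S (fG′-injective (trans fa (sym fb))))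
  placement-unique S-col (inG _ fa) (inH u∉U) = contradiction (fG′≡fH⇒∈U fa) u∉U
  placement-unique S-col (inH u∉U) (inG _ fb) = contradiction (fG′≡fH⇒∈U fb) u∉U
  placement-unique S-col (inH _)   (inH _)    = refl

  Adj-sym : ∀ {n} (Γ : Graph n) {x y} → Adj Γ x y → Adj Γ y x
  Adj-sym Γ {x} {y} = subst T (Graph.sym Γ x y)

  Cross? : ∀ a v → Dec (Cross a v)
  Cross? a v = any? λ u → (u ∈? U) ×-dec Adj? H u v ×-dec (fH ⟨$⟩ʳ u ≟ fG' a)

  cross⇒Adj : ∀ {a u v} → fG' a ≡ fH ⟨$⟩ʳ u → T (cross a v) → Adj H u v
  cross⇒Adj {a} {v = v} fa c with T-does⁻ (Cross? a v) c
  ... | u′ , _ , u′v , fu′ with fH-injective (trans fu′ fa)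
  ... | refl = u′v

  Adj⇒cross : ∀ {a u v} → u ∈ U → fG' a ≡ fH ⟨$⟩ʳ u → Adj H u v → T (cross a v)
  Adj⇒cross {a} {v = v} u∈U fa uv = T-does⁺ (Cross? a v) (_ , u∈U , uv , sym fa)

  placement-adj⇒ : ∀ {S u v y y′} → Placement S u y → Placement S v y′ → u ≢ v →
    T (adjS y y′) → Adj H u v
  placement-adj⇒ (inG _ fa) (inG _ fb) u≢v _ = U-clique _ _ (fG′≡fH⇒∈U fa) (fG′≡fH⇒∈U fb) u≢v
  placement-adj⇒ (inG _ fa) (inH _)    _   c = cross⇒Adj fa c
  placement-adj⇒ (inH _)    (inG _ fb) _   c = Adj-sym H (cross⇒Adj fb c)
  placement-adj⇒ (inH _)    (inH _)    _   e = e

  placement-adj⇐ : ∀ {S u v y y′} → IsClique G S → Placement S u y → Placement S v y′ → u ≢ v →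
    Adj H u v → T (adjS y y′)
  placement-adj⇐ S-clique (inG a∈S fa) (inG b∈S fb) u≢v _ =
    S-clique _ _ a∈S b∈S λ { refl → u≢v (fH-injective (trans (sym fa) fb)) }
  placement-adj⇐ _ (inG _ fa) (inH _)    _ uv = Adj⇒cross (fG′≡fH⇒∈U fa) fa uv
  placement-adj⇐ _ (inH _)    (inG _ fb) _ uv = Adj⇒cross (fG′≡fH⇒∈U fb) fb (Adj-sym H uv)
  placement-adj⇐ _ (inH _)    (inH _)    _ uv = uv

  module FromColourfulClique {S : Subset nG} (S-clique : IsClique G S) (S-col : Colourful fG S) where

    X : Subset (nG + nH)
    X = S ++ ∁ U

    ψ : Fin nH → Fin nG ⊎ Fin nH
    ψ u with u ∈? U
    ... | yes u∈U = inj₁ (representative S-col (fromℕ< (fH[U]<k u u∈U)))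
    ... | no _    = inj₂ u

    ψ-placement : ∀ u → Placement S u (ψ u)
    ψ-placement u with u ∈? U
    ... | no u∉U  = inH u∉U
    ... | yes u∈U = inG (representative-∈ S-col c) (toℕ-injective (begin
      toℕ (fG' (representative S-col c)) ≡⟨ toℕ-inject≤ _ k≤nH ⟩
      toℕ (fG (representative S-col c))  ≡⟨ cong toℕ (representative-colour S-col c) ⟩
      toℕ c                              ≡⟨ toℕ-fromℕ< (fH[U]<k u u∈U) ⟩
      toℕ (fH ⟨$⟩ʳ u)                    ∎))
      where
      open ≡-Reasoning
      c = fromℕ< (fH[U]<k u u∈U)

    ψ∈X : ∀ u → join nG nH (ψ u) ∈ X
    ψ∈X u = ∈-join⁺ S (placement-∈ (ψ-placement u))

    ψ-colour : ∀ u → colouring (join nG nH (ψ u)) ≡ fH ⟨$⟩ʳ u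
    ψ-colour u = trans (colouring-join (ψ u)) (placement-colour (ψ-placement u))

    X-placement : ∀ {x} → x ∈ X → Placement S (fH ⟨$⟩ˡ colouring x) (splitAt nG x)
    X-placement x∈X = placement (λ j∈∁U → j∈∁U) (∈-splitAt S x∈X) (sym (inverseʳ fH))

    ψ-onto : ∀ {x} → x ∈ X → join nG nH (ψ (fH ⟨$⟩ˡ colouring x)) ≡ x
    ψ-onto {x} x∈X = trans (cong (join nG nH) (placement-unique S-col (ψ-placement _) (X-placement x∈X)))
      (join-splitAt nG nH x)

    ψ-adj : ∀ i j → adj H i j ≡ adjS (ψ i) (ψ j)
    ψ-adj i j with i ≟ j
    ... | yes refl = trans (irrefl H i) (sym (adjS-irr (ψ i)))
    ... | no i≢j   = T-injective (placement-adj⇐ S-clique (ψ-placement i) (ψ-placement j) i≢j)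
                                 (placement-adj⇒ (ψ-placement i) (ψ-placement j) i≢j)

    X-colourful : Colourful colouring X
    X-colourful c = (join nG nH (ψ u) , ψ∈X u , trans (ψ-colour u) (inverseʳ fH))
                  , λ x y x∈X y∈X xc yc → trans (sym (ψ-onto x∈X))
                      (trans (cong (λ c → join nG nH (ψ (fH ⟨$⟩ˡ c))) (trans xc (sym yc))) (ψ-onto y∈X))
      where u = fH ⟨$⟩ˡ c

    X-iso : InducedIso H graph X
    X-iso = φ , φ-injective , φ∈X , φ-onto , φ-adj
      where
      φ : Vec (Fin (nG + nH)) nH
      φ = tabulate (join nG nH ∘ ψ)
      lookup-φ : ∀ u → lookup φ u ≡ join nG nH (ψ u)
      lookup-φ = lookup∘tabulate (join nG nH ∘ ψ)
      φ-injective : ∀ i j → lookup φ i ≡ lookup φ j → i ≡ j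
      φ-injective i j eq = fH-injective (trans (sym (ψ-colour i))
        (trans (cong colouring (trans (sym (lookup-φ i)) (trans eq (lookup-φ j)))) (ψ-colour j)))
      φ∈X : ∀ u → lookup φ u ∈ X
      φ∈X u = subst (_∈ X) (sym (lookup-φ u)) (ψ∈X u)
      φ-onto : ∀ x → x ∈ X → ∃ λ u → lookup φ u ≡ x
      φ-onto x x∈X = fH ⟨$⟩ˡ colouring x , trans (lookup-φ _) (ψ-onto x∈X)
      φ-adj : ∀ i j → adj H i j ≡ adj graph (lookup φ i) (lookup φ j)
      φ-adj i j = trans (ψ-adj i j) (sym (trans (cong₂ (adj graph) (lookup-φ i) (lookup-φ j)) (adj-join (ψ i) (ψ j))))

    colourfulCopy : X ⊆ᵛ vertexSet × Colourful colouring X × InducedIso H graph X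
    colourfulCopy = (λ _ → ++-⊆ {S = S} {⊤} {∁ U} {∁ U} (λ _ → ∈⊤) (λ j∈∁U → j∈∁U)) , X-colourful , X-iso

  module ToColourfulClique {S : Subset nG} {R : Subset nH} (X⊆V : (S ++ R) ⊆ᵛ vertexSet)
    (X-col : Colourful colouring (S ++ R)) (X-iso : InducedIso H graph (S ++ R)) where

    R⊆∁U : R ⊆ ∁ U
    R⊆∁U j∈R = ∈-++⁻ʳ ⊤ (X⊆V _ (∈-++⁺ʳ S j∈R))

    ρ : Fin nH → Fin nG ⊎ Fin nH
    ρ u = splitAt nG (representative X-col (fH ⟨$⟩ʳ u))

    ρ∈ : ∀ u → ρ u ∈⊎ (S , R)
    ρ∈ u = ∈-splitAt S (representative-∈ X-col _)

    ρ-placement : ∀ u → Placement S u (ρ u)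
    ρ-placement u = placement R⊆∁U (ρ∈ u) (representative-colour X-col _)

    ∁U⊆R : ∁ U ⊆ R
    ∁U⊆R {j} j∈∁U = on-H-side (ρ-placement j) (ρ∈ j)
      where
      on-H-side : ∀ {y} → Placement S j y → y ∈⊎ (S , R) → j ∈ R
      on-H-side (inG _ fa) _   = contradiction (fG′≡fH⇒∈U fa) (x∈∁p⇒x∉p j∈∁U)
      on-H-side (inH _)    j∈R = j∈R

    S-colourful : Colourful fG S
    S-colourful c = on-G-side (ρ-placement u) , λ a b a∈S b∈S fa fb →
      ↑ˡ-injective nH a b (colourful-injective X-col (∈-++⁺ˡ a∈S) (∈-++⁺ˡ b∈S)
        (trans (colouring-join (inj₁ a)) (trans (cong (λ c → inject≤ c k≤nH) (trans fa (sym fb)))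
          (sym (colouring-join (inj₁ b))))))
      where
      u = fH ⟨$⟩ˡ inject≤ c k≤nH
      fH-u : fH ⟨$⟩ʳ u ≡ inject≤ c k≤nH
      fH-u = inverseʳ fH
      on-G-side : ∀ {y} → Placement S u y → ∃ λ a → a ∈ S × fG a ≡ c
      on-G-side (inG {a} a∈S fa) = a , a∈S , inject≤-injective k≤nH k≤nH _ _ (trans fa fH-u)
      on-G-side (inH u∉U) = contradiction (fH<k⇒∈U (subst (_< k)
        (sym (trans (cong toℕ fH-u) (toℕ-inject≤ c k≤nH))) (toℕ<n c))) u∉U

    ρ-adj⇒ : ∀ u v → T (adjS (ρ u) (ρ v)) → Adj H u v
    ρ-adj⇒ u v with u ≟ v
    ... | yes refl = ⊥-elim ∘ subst T (adjS-irr (ρ u))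
    ... | no u≢v   = placement-adj⇒ (ρ-placement u) (ρ-placement v) u≢v

    -- ρ can only lose edges of H, and the iso shows it loses none.
    Adj⇒ρ-adj : ∀ u v → Adj H u v → T (adjS (ρ u) (ρ v))
    Adj⇒ρ-adj = edgeCount-reflects (adj H) (λ u v → adjS (ρ u) (ρ v)) ρ-adj⇒ (ℕ.≤-reflexive
      (trans (edgeCount-inducedIso {H = H} {graph} X-col X-iso)
             (sym (edgeCount-permute fH λ c d → adj graph (representative X-col c) (representative X-col d)))))

    S-clique : IsClique G S
    S-clique a b a∈S b∈S a≢b =
      subst₂ (λ y y′ → T (adjS y y′)) (ρ-at a∈S) (ρ-at b∈S) (Adj⇒ρ-adj _ _ (U-clique _ _ (∈U a) (∈U b) u≢v))
      where
      position : ∀ {a} → a ∈ S → Placement S (fH ⟨$⟩ˡ fG' a) (inj₁ a)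
      position a∈S = inG a∈S (sym (inverseʳ fH))
      ρ-at : ∀ {a} → a ∈ S → ρ (fH ⟨$⟩ˡ fG' a) ≡ inj₁ a
      ρ-at a∈S = placement-unique S-colourful (ρ-placement _) (position a∈S)
      ∈U : ∀ a → fH ⟨$⟩ˡ fG' a ∈ U
      ∈U a = fG′≡fH⇒∈U (sym (inverseʳ fH))
      u≢v : fH ⟨$⟩ˡ fG' a ≢ fH ⟨$⟩ˡ fG' b
      u≢v eq = a≢b (colourful-injective S-colourful a∈S b∈S
        (fG′-injective (trans (sym (inverseʳ fH)) (trans (cong (fH ⟨$⟩ʳ_) eq) (inverseʳ fH)))))

    colourfulClique : (∣ S ∣ ≡ k × IsClique G S × Colourful fG S) × R ≡ ∁ U
    colourfulClique = (colourful-card S-colourful , S-clique , S-colourful) , ⊆-antisym R⊆∁U ∁U⊆R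

  ColClique≡ColSubInd : ColClique k G fG ≡ ColSubInd H graph vertexSet colouring
  ColClique≡ColSubInd = sym (countSubsets-++ nG (∁ U)
    (λ X → ⊆ᵛ? X vertexSet ×-dec Colourful? colouring X ×-dec InducedIso? H graph X)
    (λ S → (∣ S ∣ ℕ.≟ k) ×-dec IsClique? G S ×-dec Colourful? fG S)
    (λ S R (X⊆V , X-col , X-iso) → ToColourfulClique.colourfulClique X⊆V X-col X-iso)
    (λ S (_ , S-clique , S-col) → FromColourfulClique.colourfulCopy S-clique S-col))

mainTheorem8 :
    ∀ {nG nH k : ℕ} (G : Graph nG) (fG : Fin nG → Fin k) (H : Graph nH) →
    (∀ (U : Subset nH) (hU : ∣ U ∣ ≡ k) → IsClique H U →
     ∀ (fH : Permutation′ nH) → (∀ u → u ∈ U → toℕ (fH ⟨$⟩ʳ u) < k) →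
     ColClique k G fG
       ≡ ColSubInd H (Construction.graph G fG H U hU fH)
                     (Construction.vertexSet G fG H U hU fH)
                     (Construction.colouring G fG H U hU fH))
    ×
    (∀ (W : Subset nH) (hW : ∣ W ∣ ≡ k) → IsIndependent H W →
     ∀ (fH : Permutation′ nH) → (∀ w → w ∈ W → toℕ (fH ⟨$⟩ʳ w) < k) →
     ColClique k G fG
       ≡ ColSubInd H (complement (Construction.graph G fG (complement H) W hW fH))
                     (Construction.vertexSet G fG (complement H) W hW fH)
                     (Construction.colouring G fG (complement H) W hW fH))
mainTheorem8 G fG H =
  (λ U ∣U∣≡k U-clique → CliqueCase.ColClique≡ColSubInd G fG H U ∣U∣≡k U-clique) ,
  λ W ∣W∣≡k W-independent fH fH[W]<k →
    let open Construction G fG (complement H) W ∣W∣≡k fH in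
    trans (CliqueCase.ColClique≡ColSubInd G fG (complement H) W ∣W∣≡k
            (independent⇒clique-complement H W-independent) fH fH[W]<k)
          (sym (ColSubInd-complement H graph vertexSet colouring))
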